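{- For each $v\in\{70,127\}$ there exists a super-simple $(v,4,2)$DD with $d\ge\frac12$.
   Context: A $(v,4,2)$DD is a pair $(X,\mathcal{B})$ with $|X|=v$ and $\mathcal{B}$ a collection of ordered $4$-tuples of distinct points (blocks) such that every ordered pair $(x,y)$ of distinct points appears in exactly $2$ blocks, where $(x,y)$ appears in $(a_1,\dots,a_4)$ if $x=a_i,y=a_j$ with $i<j$. It is super-simple if any two blocks, viewed as sets, share at most two points. A defining set is a subset of $\mathcal{B}$ contained in a unique $(v,4,2)$DD on $X$; $d$ is the size of a smallest defining set divided by $|\mathcal{B}|$. -}

module Defs where

open import Data.Nat using (ℕ; _≤_; _*_)
open import Data.Fin using (Fin; _<_; _<?_)
open import Data.Fin.Properties using (_≟_; any?)
open import Data.Vec using (Vec; lookup)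
open import Data.Vec.Membership.Propositional using (_∈_)
import Data.Vec.Membership.DecPropositional as VDec
open import Data.List using (List; length; filter; allFin; _++_)
import Data.List as L
open import Data.List.Relation.Binary.Permutation.Propositional using (_↭_)
open import Data.Product using (Σ; ∃; _×_; _,_)
open import Relation.Binary.PropositionalEquality using (_≡_; _≢_)
open import Relation.Nullary using (Dec; yes; no; ¬_)
open import Relation.Nullary.Decidable using (_×-dec_)

Block : ℕ → Set
Block v = Vec (Fin v) 4

DistinctPoints : ∀ {v} → Block v → Set
DistinctPoints b = ∀ (i j : Fin 4) → i ≢ j → lookup b i ≢ lookup b j

Appears : ∀ {v} → Fin v → Fin v → Block v → Set
Appears x y b = ∃ λ (i : Fin 4) → ∃ λ (j : Fin 4) →
  (i < j) × (lookup b i ≡ x) × (lookup b j ≡ y)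

appears? : ∀ {v} (x y : Fin v) (b : Block v) → Dec (Appears x y b)
appears? x y b = any? λ i → any? λ j →
  (i <? j) ×-dec ((lookup b i ≟ x) ×-dec (lookup b j ≟ y))

pairCount : ∀ {v} → Fin v → Fin v → List (Block v) → ℕ
pairCount x y B = length (filter (appears? x y) B)

IsDD : (v : ℕ) → List (Block v) → Set
IsDD v B =
  (∀ (k : Fin (length B)) → DistinctPoints (L.lookup B k)) ×
  (∀ (x y : Fin v) → x ≢ y → pairCount x y B ≡ 2)

commonPoints : ∀ {v} → Block v → Block v → ℕ
commonPoints {v} b c =
  length (filter (λ x → (x ∈? b) ×-dec (x ∈? c)) (allFin v))
  where open VDec (_≟_ {v}) using (_∈?_)

SuperSimple : (v : ℕ) → List (Block v) → Set
SuperSimple v B = ∀ (k l : Fin (length B)) → k ≢ l →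
  commonPoints (L.lookup B k) (L.lookup B l) ≤ 2

SubCollection : ∀ {v} → List (Block v) → List (Block v) → Set
SubCollection {v} S B = ∃ λ (T : List (Block v)) → (S L.++ T) ↭ B

IsDefiningSet : (v : ℕ) → List (Block v) → List (Block v) → Set
IsDefiningSet v B S = SubCollection S B ×
  (∀ (B′ : List (Block v)) → IsDD v B′ → SubCollection S B′ → B′ ↭ B)

-- d ≥ 1/2: every defining set S (in particular a smallest one)
-- satisfies |S| / |B| ≥ 1/2, i.e. |B| ≤ 2 |S|.
dAtLeastHalf : (v : ℕ) → List (Block v) → Set
dAtLeastHalf v B = ∀ (S : List (Block v)) → IsDefiningSet v B S →
  length B ≤ 2 * length S

-- Each design below is a union of trades: the blocks (x,y,c,d) and (y,x,e,f) cover exactly the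
-- same ordered pairs as (y,x,c,d) and (x,y,e,f). If a defining set S contained neither block of
-- some trade, switching that trade would give a (v,4,2)DD that also contains S, hence equals the
-- original one as a collection; so (y,x,c,d) would be a block sharing the three points x, y, c
-- with the different block (x,y,c,d), contradicting super-simplicity. Thus S meets every trade,
-- and |S| ≥ #trades = |B|/2. That the concrete collections are super-simple DDs is checked by
-- computation: the sorted codes of the ordered pairs covered by the blocks are compared with
-- those of every ordered pair of distinct points taken twice, and the codes of the 3-subsets of
-- the blocks are checked to be pairwise distinct.
module Submission where

open import Defs
open import Data.Nat using (ℕ)
open import Data.List using (List)
open import Data.Sum using (_⊎_)
open import Data.Product using (Σ; _×_)
open import Relation.Binary.PropositionalEquality using (_≡_)

import Relation.Binary.PropositionalEquality as ≡
open import Data.Empty using (⊥-elim)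
open import Data.Fin as Fin using (Fin; toℕ; combine) renaming (zero to fzero; suc to fsuc)
import Data.Fin.Properties as Fin
open import Data.Fin.Properties using (toℕ-injective; toℕ<n; toℕ-combine; combine-injective; <-cmp)
open import Data.List
  using ([]; _∷_; _++_; [_]; length; filter; map; concatMap; lookup; allFin; cartesianProduct; upTo; downFrom)
open import Data.List.Properties using (length-++; filter-++; filter-accept; filter-reject; ≡-dec)
open import Data.List.Membership.Propositional using (_∈_; _∉_; lose)
open import Data.List.Membership.Propositional.Properties
  using (∈-∃++; ∈-++⁺ʳ; ∈-++⁻; ∈-lookup; ∈-map⁺; ∈-map⁻; ∈-filter⁺; ∈-filter⁻; ∈-concatMap⁺;
         ∈-allFin; ∈-downFrom⁺; ∈-cartesianProduct⁺)
import Data.List.Membership.DecPropositional as ListDec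
open import Data.List.Relation.Binary.Subset.Propositional using (_⊆_)
open import Data.List.Relation.Binary.Subset.Propositional.Properties using (xs⊆xs++ys)
open import Data.List.Relation.Binary.Permutation.Propositional
  using (_↭_; refl; prep; swap; trans; ↭-refl; ↭-reflexive; ↭-sym; ↭-trans; ↭⇒↭ₛ; module PermutationReasoning)
open import Data.List.Relation.Binary.Permutation.Propositional.Properties
  using (∈-resp-↭; ↭-length; shift; shifts; ++⁺ˡ; drop-∷; ∷↭∷ʳ; filter-↭)
  renaming (map⁺ to map-↭)
open import Data.List.Relation.Binary.Permutation.Setoid.Properties (≡.setoid ℕ) using (Unique-resp-↭)
open import Data.List.Relation.Unary.All using (All; []; _∷_)
import Data.List.Relation.Unary.All as All
open import Data.List.Relation.Unary.Any using (Any; here; there; any?)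
import Data.List.Relation.Unary.Any as Any
open import Data.List.Relation.Unary.Any.Properties using (lookup-index)
import Data.List.Relation.Unary.AllPairs as AllPairs
open import Data.List.Relation.Unary.Linked using (Linked; linked?)
open import Data.List.Relation.Unary.Linked.Properties using (Linked⇒AllPairs)
open import Data.List.Relation.Unary.Unique.Propositional using (Unique)
open import Data.List.Relation.Unary.Unique.Propositional.Properties
  using (map⁺; filter⁺; take⁺; cartesianProduct⁺; allFin⁺; downFrom⁺)
open import Data.Nat using (suc; _+_; _*_; _^_; _%_; _≤_; _<_; z≤n; s≤s; _≟_; NonZero)
open import Data.Nat.DivMod using (_mod_; [m+kn]%n≡m%n; m<n⇒m%n≡m)
open import Data.Nat.ListAction using (sum)
open import Data.Nat.ListAction.Properties using (sum-↭)
open import Data.Nat.Properties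
  using (_≤?_; _<?_; ≤-decTotalOrder; <-trans; <⇒≢; ≰⇒>; ≤⇒≯; m≤m+n; +-mono-≤; *-monoʳ-≤;
         +-comm; *-comm; *-suc; +-cancelˡ-≡; module ≤-Reasoning)
open import Data.List.Sort.MergeSort ≤-decTotalOrder using (sort)
open import Data.List.Sort.MergeSort.Properties ≤-decTotalOrder using (sort-↭)
open import Data.Product using (∃; _,_; proj₁; proj₂; uncurry)
open import Data.Sum using (inj₁; inj₂)
import Data.Vec as Vec
import Data.Vec.Properties as Vecₚ
open import Data.Vec using (_∷_; [])
open import Data.Vec.Membership.Propositional using () renaming (_∈_ to _∈ᵥ_)
open import Data.Vec.Membership.Propositional.Properties using (∈-toList⁺)
import Data.Vec.Membership.DecPropositional as VecDec
import Data.Vec.Relation.Unary.Any as VecAny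
open import Function using (_∘_; _⇔_; mk⇔; Equivalence)
open import Relation.Binary.Definitions using (tri<; tri≈; tri>)
open import Relation.Binary.PropositionalEquality using (_≢_; refl; sym; cong; cong₂; subst; subst₂)
open import Relation.Nullary using (¬_; ¬?; yes; no)
open import Relation.Nullary.Decidable using (_×-dec_; decidable-stable; True; toWitness)
open import Relation.Unary using (Decidable)

private variable
  A B : Set
  x y : A
  xs ys zs : List A

∈⇒↭∷ : x ∈ xs → ∃ λ ys → xs ↭ x ∷ ys
∈⇒↭∷ x∈xs with ys , zs , refl ← ∈-∃++ x∈xs = ys ++ zs , shift _ ys zs

∈-↭∷-≢ : x ≢ y → xs ↭ x ∷ ys → y ∈ xs → y ∈ ys
∈-↭∷-≢ x≢y p y∈xs with ∈-resp-↭ p y∈xs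
... | here refl = ⊥-elim (x≢y refl)
... | there y∈ys = y∈ys

∈-∈⇒↭∷∷ : x ∈ xs → y ∈ xs → x ≢ y → ∃ λ zs → xs ↭ x ∷ y ∷ zs
∈-∈⇒↭∷∷ x∈xs y∈xs x≢y
  with ys , xs↭ ← ∈⇒↭∷ x∈xs
  with zs , ys↭ ← ∈⇒↭∷ (∈-↭∷-≢ x≢y xs↭ y∈xs)
  = zs , ↭-trans xs↭ (prep _ ys↭)

∈-complement : xs ++ ys ↭ zs → x ∈ zs → x ∉ xs → x ∈ ys
∈-complement {xs = xs} xs++ys↭ x∈zs x∉xs with ∈-++⁻ xs (∈-resp-↭ (↭-sym xs++ys↭) x∈zs)
... | inj₁ x∈xs = ⊥-elim (x∉xs x∈xs)
... | inj₂ x∈ys = x∈ys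

↭-exchange : ∀ (x y : A) xs ys → x ∷ xs ++ y ∷ ys ↭ y ∷ xs ++ x ∷ ys
↭-exchange x y xs ys = begin
  x ∷ xs ++ y ∷ ys   ↭⟨ prep x (shift y xs ys) ⟩
  x ∷ y ∷ xs ++ ys   ↭⟨ swap x y ↭-refl ⟩
  y ∷ x ∷ xs ++ ys   ↭⟨ prep y (shift x xs ys) ⟨
  y ∷ xs ++ x ∷ ys   ∎
  where open PermutationReasoning

Unique-⊆⇒↭++ : Unique xs → xs ⊆ ys → ∃ λ zs → ys ↭ xs ++ zs
Unique-⊆⇒↭++ {xs = []} {ys} _ _ = ys , ↭-refl
Unique-⊆⇒↭++ {xs = x ∷ xs} (x∉xs AllPairs.∷ uxs) xs⊆ys
  with ys′ , ys↭ ← ∈⇒↭∷ (xs⊆ys (here refl))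
  with zs , ys′↭ ← Unique-⊆⇒↭++ uxs (λ y∈xs → ∈-↭∷-≢ (All.lookup x∉xs y∈xs) ys↭ (xs⊆ys (there y∈xs)))
  = zs , ↭-trans ys↭ (prep x ys′↭)

Unique-⊆⇒length≤ : Unique xs → xs ⊆ ys → length xs ≤ length ys
Unique-⊆⇒length≤ {xs = xs} uxs xs⊆ys with zs , ys↭ ← Unique-⊆⇒↭++ uxs xs⊆ys
  rewrite ↭-length ys↭ | length-++ xs {zs} = m≤m+n _ _

Unique-++⇒∉ : Unique (xs ++ ys) → x ∈ xs → x ∉ ys
Unique-++⇒∉ {xs = _ ∷ xs} (x∉ AllPairs.∷ _) (here refl) x∈ys = All.lookup x∉ (∈-++⁺ʳ xs x∈ys) refl
Unique-++⇒∉ (_ AllPairs.∷ u) (there x∈xs) = Unique-++⇒∉ u x∈xs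

Unique-++ʳ : ∀ xs → Unique (xs ++ ys) → Unique ys
Unique-++ʳ [] u = u
Unique-++ʳ (_ ∷ xs) (_ AllPairs.∷ u) = Unique-++ʳ xs u

sort-≡⇒↭ : {xs ys : List ℕ} → sort xs ≡ sort ys → xs ↭ ys
sort-≡⇒↭ {xs} {ys} eq = ↭-trans (↭-sym (sort-↭ xs)) (↭-trans (↭-reflexive eq) (sort-↭ ys))

Linked<-sort⇒Unique : {xs : List ℕ} → Linked _<_ (sort xs) → Unique xs
Linked<-sort⇒Unique {xs} linked =
  Unique-resp-↭ (↭⇒↭ₛ (sort-↭ xs)) (AllPairs.map <⇒≢ (Linked⇒AllPairs <-trans linked))

Any⇒1≤length-filter : {P : A → Set} (P? : Decidable P) → Any P xs → 1 ≤ length (filter P? xs)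
Any⇒1≤length-filter P? (here {x} px) with P? x
... | yes _ = s≤s z≤n
... | no ¬px = ⊥-elim (¬px px)
Any⇒1≤length-filter P? (there {x} any) with P? x
... | yes _ = s≤s z≤n
... | no _ = Any⇒1≤length-filter P? any

module _ (f : A → List B) where

  ∈-concatMap⁺′ : ∀ {a as} {y : B} → a ∈ as → y ∈ f a → y ∈ concatMap f as
  ∈-concatMap⁺′ a∈as y∈fa = ∈-concatMap⁺ f (lose a∈as y∈fa)

  concatMap-↭ : xs ↭ ys → concatMap f xs ↭ concatMap f ys
  concatMap-↭ refl = ↭-refl
  concatMap-↭ (prep x p) = ++⁺ˡ (f x) (concatMap-↭ p)
  concatMap-↭ (swap x y p) = ↭-trans (++⁺ˡ (f x) (++⁺ˡ (f y) (concatMap-↭ p))) (shifts (f x) (f y))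
  concatMap-↭ (trans p q) = ↭-trans (concatMap-↭ p) (concatMap-↭ q)

  Unique-concatMap⇒disjoint : ∀ {as : List A} {y} (k l : Fin (length as)) → k ≢ l →
    Unique (concatMap f as) → y ∈ f (lookup as k) → y ∉ f (lookup as l)
  Unique-concatMap⇒disjoint {a ∷ as} fzero fzero k≢l = ⊥-elim (k≢l refl)
  Unique-concatMap⇒disjoint {a ∷ as} fzero (fsuc l) _ u y∈ y∈′ =
    Unique-++⇒∉ u y∈ (∈-concatMap⁺′ (∈-lookup {xs = as} l) y∈′)
  Unique-concatMap⇒disjoint {a ∷ as} (fsuc k) fzero _ u y∈ y∈′ =
    Unique-++⇒∉ u y∈′ (∈-concatMap⁺′ (∈-lookup {xs = as} k) y∈)
  Unique-concatMap⇒disjoint {a ∷ as} (fsuc k) (fsuc l) k≢l u =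
    Unique-concatMap⇒disjoint {as} k l (k≢l ∘ cong fsuc) (Unique-++ʳ (f a) u)

  Unique-concatMap⇒Unique : (∀ a → ∃ λ y → y ∈ f a) → Unique (concatMap f xs) → Unique xs
  Unique-concatMap⇒Unique {xs = []} _ _ = AllPairs.[]
  Unique-concatMap⇒Unique {xs = a ∷ as} nonEmpty u =
    All.tabulate (λ { a∈as refl → Unique-++⇒∉ u y∈fa (∈-concatMap⁺′ a∈as y∈fa) })
    AllPairs.∷ Unique-concatMap⇒Unique nonEmpty (Unique-++ʳ (f a) u)
    where y∈fa = proj₂ (nonEmpty a)

deletions : List A → List (List A)
deletions [] = []
deletions (x ∷ xs) = xs ∷ map (x ∷_) (deletions xs)

∈-deletions : ∀ (xs : List A) {y} ys → xs ++ ys ∈ deletions (xs ++ y ∷ ys)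
∈-deletions [] ys = here refl
∈-deletions (x ∷ xs) ys = there (∈-map⁺ (x ∷_) (∈-deletions xs ys))

length≡1⇒singleton : length xs ≡ 1 → ∃ λ x → xs ≡ [ x ]
length≡1⇒singleton {xs = x ∷ []} _ = x , refl

complement-length≡1 : ys ↭ xs ++ zs → suc (length xs) ≡ length ys → length zs ≡ 1
complement-length≡1 {ys = ys} {xs} {zs} ys↭ size = sym (+-cancelˡ-≡ (length xs) _ _ (begin
  length xs + 1         ≡⟨ +-comm (length xs) 1 ⟩
  suc (length xs)       ≡⟨ size ⟩
  length ys             ≡⟨ ↭-length ys↭ ⟩
  length (xs ++ zs)     ≡⟨ length-++ xs ⟩
  length xs + length zs ∎))
  where open ≡.≡-Reasoning

Unique-⊆⇒↭deletion : Unique xs → xs ⊆ ys → suc (length xs) ≡ length ys →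
  ∃ λ zs → zs ∈ deletions ys × xs ↭ zs
Unique-⊆⇒↭deletion {xs = xs} {ys} uxs xs⊆ys size
  with rest , ys↭ ← Unique-⊆⇒↭++ uxs xs⊆ys
  with w , refl ← length≡1⇒singleton {xs = rest} (complement-length≡1 {xs = xs} ys↭ size)
  with as , bs , refl ← ∈-∃++ (∈-resp-↭ (↭-sym ys↭) (∈-++⁺ʳ xs (here refl)))
  = as ++ bs , ∈-deletions as bs , drop-∷ (begin
      w ∷ xs         ↭⟨ ∷↭∷ʳ w xs ⟩
      xs ++ [ w ]    ↭⟨ ys↭ ⟨
      as ++ w ∷ bs   ↭⟨ shift w as bs ⟩
      w ∷ as ++ bs   ∎)
  where open PermutationReasoning

count : ℕ → List ℕ → ℕ
count c xs = length (filter (c ≟_) xs)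

module _ {c : ℕ} where

  count-++ : ∀ xs ys → count c (xs ++ ys) ≡ count c xs + count c ys
  count-++ xs ys = ≡.trans (cong length (filter-++ (c ≟_) xs ys)) (length-++ (filter (c ≟_) xs))

  count-↭ : xs ↭ ys → count c xs ≡ count c ys
  count-↭ p = ↭-length (filter-↭ (c ≟_) p)

  count-∉ : c ∉ xs → count c xs ≡ 0
  count-∉ {[]} _ = refl
  count-∉ {x ∷ xs} c∉ = ≡.trans (cong length (filter-reject (c ≟_) (c∉ ∘ here))) (count-∉ (c∉ ∘ there))

  count-Unique : Unique xs → c ∈ xs → count c xs ≡ 1
  count-Unique {x ∷ xs} (x∉xs AllPairs.∷ _) (here refl) =
    ≡.trans (cong length (filter-accept (c ≟_) refl)) (cong suc (count-∉ {xs} (λ c∈xs → All.lookup x∉xs c∈xs refl)))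
  count-Unique {x ∷ xs} (x∉xs AllPairs.∷ u) (there c∈xs) =
    ≡.trans (cong length (filter-reject (c ≟_) (λ c≡x → All.lookup x∉xs c∈xs (sym c≡x)))) (count-Unique u c∈xs)

length-filter≡count-concatMap : {P : A → Set} (P? : Decidable P) (f : A → List ℕ) (c : ℕ) {as : List A} →
  All (λ a → Unique (f a) × (P a → c ∈ f a) × (c ∈ f a → P a)) as →
  length (filter P? as) ≡ count c (concatMap f as)
length-filter≡count-concatMap P? f c [] = refl
length-filter≡count-concatMap P? f c {a ∷ as} ((u , sound , complete) ∷ rest) with P? a
... | yes pa = ≡.trans (cong suc (length-filter≡count-concatMap P? f c rest))
  (sym (≡.trans (count-++ (f a) _) (cong (_+ _) (count-Unique u (sound pa)))))
... | no ¬pa = ≡.trans (length-filter≡count-concatMap P? f c rest)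
  (sym (≡.trans (count-++ (f a) _) (cong (_+ _) (count-∉ (¬pa ∘ complete)))))

-- Pair codes

private variable
  v : ℕ
  x′ y′ : Fin v
  b c : Block v
  bs : List (Block v)

pairCode : Fin v → Fin v → ℕ
pairCode {v} x y = v * toℕ x + toℕ y

pairCode-injective : pairCode x y ≡ pairCode x′ y′ → x ≡ x′ × y ≡ y′
pairCode-injective {x = x} {y} {x′} {y′} eq =
  combine-injective x y x′ y′ (toℕ-injective (begin
    toℕ (combine x y)   ≡⟨ toℕ-combine x y ⟩
    pairCode x y        ≡⟨ eq ⟩
    pairCode x′ y′      ≡⟨ toℕ-combine x′ y′ ⟨
    toℕ (combine x′ y′) ∎))
  where open ≡.≡-Reasoning

indexPairs : List (Fin 4 × Fin 4)
indexPairs = filter (uncurry Fin._<?_) (cartesianProduct (allFin 4) (allFin 4))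

pairCodeAt : Block v → Fin 4 × Fin 4 → ℕ
pairCodeAt b (i , j) = pairCode (Vec.lookup b i) (Vec.lookup b j)

pairCodes : Block v → List ℕ
pairCodes b = map (pairCodeAt b) indexPairs

allPairCodes : List (Block v) → List ℕ
allPairCodes = concatMap pairCodes

Appears⇒∈pairCodes : Appears x y b → pairCode x y ∈ pairCodes b
Appears⇒∈pairCodes {b = b} (i , j , i<j , refl , refl) =
  ∈-map⁺ (pairCodeAt b) (∈-filter⁺ (uncurry Fin._<?_) (∈-cartesianProduct⁺ (∈-allFin i) (∈-allFin j)) i<j)

∈pairCodes⇒Appears : pairCode x y ∈ pairCodes b → Appears x y b
∈pairCodes⇒Appears {b = b} p∈
  with (i , j) , ij∈ , eq ← ∈-map⁻ (pairCodeAt b) p∈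
  with x≡ , y≡ ← pairCode-injective eq =
  i , j , proj₂ (∈-filter⁻ (uncurry Fin._<?_) {xs = cartesianProduct (allFin 4) (allFin 4)} ij∈) , sym x≡ , sym y≡

DistinctPoints⇒lookup-injective : DistinctPoints b → ∀ {i j} → Vec.lookup b i ≡ Vec.lookup b j → i ≡ j
DistinctPoints⇒lookup-injective D {i} {j} eq with i Fin.≟ j
... | yes i≡j = i≡j
... | no i≢j = ⊥-elim (D i j i≢j eq)

pairCodes-Unique : DistinctPoints b → Unique (pairCodes b)
pairCodes-Unique {b = b} D = map⁺ injective (filter⁺ (uncurry Fin._<?_) (cartesianProduct⁺ (allFin⁺ 4) (allFin⁺ 4)))
  where
  injective : ∀ {p q} → pairCodeAt b p ≡ pairCodeAt b q → p ≡ q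
  injective {i , j} {k , l} eq with i≡k , j≡l ← pairCode-injective eq =
    cong₂ _,_ (DistinctPoints⇒lookup-injective {b = b} D i≡k) (DistinctPoints⇒lookup-injective {b = b} D j≡l)

¬Appears-diagonal⇒DistinctPoints : (∀ z → ¬ Appears z z b) → DistinctPoints b
¬Appears-diagonal⇒DistinctPoints noDiagonal i j i≢j eq with <-cmp i j
... | tri< i<j _ _ = noDiagonal _ (i , j , i<j , refl , sym eq)
... | tri≈ _ i≡j _ = i≢j i≡j
... | tri> _ _ j<i = noDiagonal _ (j , i , j<i , refl , eq)

pairCount≡count : All DistinctPoints bs → pairCount x y bs ≡ count (pairCode x y) (allPairCodes bs)
pairCount≡count {x = x} {y} distinct = length-filter≡count-concatMap (appears? x y) pairCodes (pairCode x y)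
  (All.map (λ {b} D → pairCodes-Unique {b = b} D , Appears⇒∈pairCodes {b = b} , ∈pairCodes⇒Appears {b = b}) distinct)

module _ (v : ℕ) ⦃ _ : NonZero v ⦄ where

  -- The code of (z , z) is z * (v + 1), and the remainder mod v of any code is its second point.
  IsDiagonalCode : ℕ → Set
  IsDiagonalCode k = k ≡ k % v * suc v

  offDiagonalCodes : List ℕ
  offDiagonalCodes = filter (λ k → ¬? (k ≟ k % v * suc v)) (downFrom (v * v))

  expectedPairCodes : List ℕ
  expectedPairCodes = offDiagonalCodes ++ offDiagonalCodes

module _ ⦃ _ : NonZero v ⦄ where

  pairCode-< : (x y : Fin v) → pairCode x y < v * v
  pairCode-< x y = subst (_< v * v) (toℕ-combine x y) (toℕ<n (combine x y))

  pairCode-% : (x y : Fin v) → pairCode x y % v ≡ toℕ y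
  pairCode-% x y = begin
    (v * toℕ x + toℕ y) % v ≡⟨ cong (_% v) (+-comm (v * toℕ x) (toℕ y)) ⟩
    (toℕ y + v * toℕ x) % v ≡⟨ cong (λ n → (toℕ y + n) % v) (*-comm v (toℕ x)) ⟩
    (toℕ y + toℕ x * v) % v ≡⟨ [m+kn]%n≡m%n (toℕ y) (toℕ x) v ⟩
    toℕ y % v               ≡⟨ m<n⇒m%n≡m (toℕ<n y) ⟩
    toℕ y                   ∎
    where open ≡.≡-Reasoning

  pairCode-diagonal : (z : Fin v) → toℕ z * suc v ≡ pairCode z z
  pairCode-diagonal z = begin
    toℕ z * suc v       ≡⟨ *-suc (toℕ z) v ⟩
    toℕ z + toℕ z * v   ≡⟨ +-comm (toℕ z) (toℕ z * v) ⟩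
    toℕ z * v + toℕ z   ≡⟨ cong (_+ toℕ z) (*-comm (toℕ z) v) ⟩
    v * toℕ z + toℕ z   ∎
    where open ≡.≡-Reasoning

  IsDiagonalCode-pairCode : {x y : Fin v} → IsDiagonalCode v (pairCode x y) ⇔ x ≡ y
  IsDiagonalCode-pairCode {x} {y} = mk⇔ to from
    where
    to : IsDiagonalCode v (pairCode x y) → x ≡ y
    to diagonal = proj₁ (pairCode-injective
      (≡.trans diagonal (≡.trans (cong (_* suc v) (pairCode-% x y)) (pairCode-diagonal y))))
    from : x ≡ y → IsDiagonalCode v (pairCode x y)
    from refl = sym (≡.trans (cong (_* suc v) (pairCode-% x x)) (pairCode-diagonal x))

  offDiagonalCodes-Unique : Unique (offDiagonalCodes v)
  offDiagonalCodes-Unique = filter⁺ _ (downFrom⁺ (v * v))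

  ∈offDiagonalCodes⇔≢ : {x y : Fin v} → pairCode x y ∈ offDiagonalCodes v ⇔ x ≢ y
  ∈offDiagonalCodes⇔≢ = mk⇔
    (λ p∈ → proj₂ (∈-filter⁻ _ {xs = downFrom (v * v)} p∈) ∘ Equivalence.from IsDiagonalCode-pairCode)
    (λ x≢y → ∈-filter⁺ _ (∈-downFrom⁺ (pairCode-< _ _)) (x≢y ∘ Equivalence.to IsDiagonalCode-pairCode))

  count-expectedPairCodes : {x y : Fin v} → x ≢ y → count (pairCode x y) (expectedPairCodes v) ≡ 2
  count-expectedPairCodes x≢y =
    ≡.trans (count-++ (offDiagonalCodes v) _) (cong₂ _+_ once once)
    where once = count-Unique offDiagonalCodes-Unique (Equivalence.from ∈offDiagonalCodes⇔≢ x≢y)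

  pairCode-diagonal∉expectedPairCodes : (z : Fin v) → pairCode z z ∉ expectedPairCodes v
  pairCode-diagonal∉expectedPairCodes z z∈ with ∈-++⁻ (offDiagonalCodes v) z∈
  ... | inj₁ z∈off = Equivalence.to ∈offDiagonalCodes⇔≢ z∈off refl
  ... | inj₂ z∈off = Equivalence.to ∈offDiagonalCodes⇔≢ z∈off refl

  PairBalanced : List (Block v) → Set
  PairBalanced bs = allPairCodes bs ↭ expectedPairCodes v

  PairBalanced-resp-↭ : bs ↭ ys → PairBalanced bs → PairBalanced ys
  PairBalanced-resp-↭ p balanced = ↭-trans (concatMap-↭ pairCodes (↭-sym p)) balanced

  PairBalanced⇒DistinctPoints : PairBalanced bs → b ∈ bs → DistinctPoints b
  PairBalanced⇒DistinctPoints {b = b} balanced b∈bs = ¬Appears-diagonal⇒DistinctPoints {b = b} λ z appears →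
    pairCode-diagonal∉expectedPairCodes z
      (∈-resp-↭ balanced (∈-concatMap⁺′ pairCodes b∈bs (Appears⇒∈pairCodes {b = b} appears)))

  PairBalanced⇒IsDD : PairBalanced bs → IsDD v bs
  PairBalanced⇒IsDD {bs} balanced = (λ k → distinct (∈-lookup {xs = bs} k)) , λ x y x≢y → begin
    pairCount x y bs                            ≡⟨ pairCount≡count {bs = bs} (All.tabulate distinct) ⟩
    count (pairCode x y) (allPairCodes bs)      ≡⟨ count-↭ balanced ⟩
    count (pairCode x y) (expectedPairCodes v)  ≡⟨ count-expectedPairCodes x≢y ⟩
    2                                           ∎
    where
    open ≡.≡-Reasoning
    distinct : ∀ {b} → b ∈ bs → DistinctPoints b
    distinct = PairBalanced⇒DistinctPoints {bs = bs} balanced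

-- Triple codes and super-simplicity

-- The binary encoding of a set of points: injective on sets, which makes the computational
-- check possible; the proofs only use its invariance under permutations.
subsetCode : List (Fin v) → ℕ
subsetCode = sum ∘ map (λ a → 2 ^ toℕ a)

subsetCode-↭ : {xs ys : List (Fin v)} → xs ↭ ys → subsetCode xs ≡ subsetCode ys
subsetCode-↭ p = sum-↭ (map-↭ _ p)

tripleCodes : Block v → List ℕ
tripleCodes b = map subsetCode (deletions (Vec.toList b))

allTripleCodes : List (Block v) → List ℕ
allTripleCodes = concatMap tripleCodes

subsetCode∈tripleCodes : {T : List (Fin v)} → Unique T → length T ≡ 3 → T ⊆ Vec.toList b →
  subsetCode T ∈ tripleCodes b
subsetCode∈tripleCodes {b = b} uT size T⊆b
  with zs , zs∈ , T↭zs ← Unique-⊆⇒↭deletion uT T⊆b (≡.trans (cong suc size) (sym (Vecₚ.length-toList b)))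
  = subst (_∈ tripleCodes b) (sym (subsetCode-↭ T↭zs)) (∈-map⁺ subsetCode zs∈)

commonPointList : Block v → Block v → List (Fin v)
commonPointList {v} b c = filter (λ x → (x ∈ᵥ? b) ×-dec (x ∈ᵥ? c)) (allFin v)
  where open VecDec (Fin._≟_ {v}) renaming (_∈?_ to _∈ᵥ?_)

module _ {b c : Block v} where

  ∈-commonPointList⁺ : x ∈ᵥ b → x ∈ᵥ c → x ∈ commonPointList b c
  ∈-commonPointList⁺ x∈b x∈c = ∈-filter⁺ _ (∈-allFin _) (x∈b , x∈c)

  ∈-commonPointList⁻ : x ∈ commonPointList b c → x ∈ᵥ b × x ∈ᵥ c
  ∈-commonPointList⁻ x∈ = proj₂ (∈-filter⁻ _ {xs = allFin _} x∈)

  length≤commonPoints : {T : List (Fin v)} → Unique T → (∀ {x} → x ∈ T → x ∈ᵥ b × x ∈ᵥ c) →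
    length T ≤ commonPoints b c
  length≤commonPoints uT shared = Unique-⊆⇒length≤ uT (uncurry ∈-commonPointList⁺ ∘ shared)

  3≤commonPoints⇒shared-tripleCode : 3 ≤ commonPoints b c → ∃ λ t → t ∈ tripleCodes b × t ∈ tripleCodes c
  3≤commonPoints⇒shared-tripleCode = go (filter⁺ _ (allFin⁺ _)) ∈-commonPointList⁻
    where
    go : ∀ {U} → Unique U → (∀ {x} → x ∈ U → x ∈ᵥ b × x ∈ᵥ c) → 3 ≤ length U →
      ∃ λ t → t ∈ tripleCodes b × t ∈ tripleCodes c
    go {[]} _ _ ()
    go {_ ∷ []} _ _ (s≤s ())
    go {_ ∷ _ ∷ []} _ _ (s≤s (s≤s ()))
    go {u₁ ∷ u₂ ∷ u₃ ∷ U} uU shared _ = subsetCode T , code proj₁ , code proj₂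
      where
      T = u₁ ∷ u₂ ∷ u₃ ∷ []
      code : ∀ {d} → (∀ {x} → x ∈ᵥ b × x ∈ᵥ c → x ∈ᵥ d) → subsetCode T ∈ tripleCodes d
      code select = subsetCode∈tripleCodes (take⁺ 3 uU) refl (∈-toList⁺ ∘ select ∘ shared ∘ xs⊆xs++ys T U)

Unique-allTripleCodes⇒SuperSimple : Unique (allTripleCodes bs) → SuperSimple v bs
Unique-allTripleCodes⇒SuperSimple {bs = bs} u k l k≢l with commonPoints (lookup bs k) (lookup bs l) ≤? 2
... | yes ≤2 = ≤2
... | no ≰2 with t , t∈k , t∈l ← 3≤commonPoints⇒shared-tripleCode {b = lookup bs k} {lookup bs l} (≰⇒> ≰2) =
  ⊥-elim (Unique-concatMap⇒disjoint tripleCodes {as = bs} k l k≢l u t∈k t∈l)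

Unique-allTripleCodes⇒Unique : Unique (allTripleCodes bs) → Unique bs
Unique-allTripleCodes⇒Unique = Unique-concatMap⇒Unique tripleCodes λ { (_ ∷ _) → _ , here refl }

SuperSimple-3≤commonPoints⇒≡ : SuperSimple v bs → b ∈ bs → c ∈ bs → 3 ≤ commonPoints b c → b ≡ c
SuperSimple-3≤commonPoints⇒≡ {bs = bs} superSimple b∈ c∈ 3≤ with Any.index b∈ Fin.≟ Any.index c∈
... | yes k≡l = ≡.trans (lookup-index b∈) (≡.trans (cong (lookup bs) k≡l) (sym (lookup-index c∈)))
... | no k≢l = ⊥-elim (≤⇒≯ (superSimple _ _ k≢l)
  (subst₂ (λ b′ c′ → 3 ≤ commonPoints b′ c′) (lookup-index b∈) (lookup-index c∈) 3≤))

-- Trades and defining sets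

data Trade (v : ℕ) : Set where
  trade : (x y c d e f : Fin v) → Trade v

tradeBlocks : Trade v → List (Block v)
tradeBlocks (trade x y c d e f) = (x ∷ y ∷ c ∷ d ∷ []) ∷ (y ∷ x ∷ e ∷ f ∷ []) ∷ []

switchedBlocks : Trade v → List (Block v)
switchedBlocks (trade x y c d e f) = (y ∷ x ∷ c ∷ d ∷ []) ∷ (x ∷ y ∷ e ∷ f ∷ []) ∷ []

blocks : List (Trade v) → List (Block v)
blocks = concatMap tradeBlocks

length-blocks : (P : List (Trade v)) → length (blocks P) ≡ 2 * length P
length-blocks [] = refl
length-blocks (trade _ _ _ _ _ _ ∷ P) = ≡.trans (cong (2 +_) (length-blocks P)) (sym (*-suc 2 (length P)))

switch-preserves-pairCodes : (t : Trade v) (bs : List (Block v)) →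
  allPairCodes (switchedBlocks t ++ bs) ↭ allPairCodes (tradeBlocks t ++ bs)
switch-preserves-pairCodes (trade x y c d e f) bs = begin
  ⦅ y , x ⦆ ∷ ⦅ y , c ⦆ ∷ ⦅ y , d ⦆ ∷ ⦅ x , c ⦆ ∷ ⦅ x , d ⦆ ∷ ⦅ c , d ⦆ ∷
  ⦅ x , y ⦆ ∷ ⦅ x , e ⦆ ∷ ⦅ x , f ⦆ ∷ ⦅ y , e ⦆ ∷ ⦅ y , f ⦆ ∷ ⦅ e , f ⦆ ∷ rest
    ↭⟨ prep ⦅ y , x ⦆ (shifts (⦅ y , c ⦆ ∷ ⦅ y , d ⦆ ∷ []) (⦅ x , c ⦆ ∷ ⦅ x , d ⦆ ∷ [])) ⟩
  ⦅ y , x ⦆ ∷ ⦅ x , c ⦆ ∷ ⦅ x , d ⦆ ∷ ⦅ y , c ⦆ ∷ ⦅ y , d ⦆ ∷ ⦅ c , d ⦆ ∷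
  ⦅ x , y ⦆ ∷ ⦅ x , e ⦆ ∷ ⦅ x , f ⦆ ∷ ⦅ y , e ⦆ ∷ ⦅ y , f ⦆ ∷ ⦅ e , f ⦆ ∷ rest
    ↭⟨ ++⁺ˡ (⦅ y , x ⦆ ∷ ⦅ x , c ⦆ ∷ ⦅ x , d ⦆ ∷ ⦅ y , c ⦆ ∷ ⦅ y , d ⦆ ∷ ⦅ c , d ⦆ ∷ ⦅ x , y ⦆ ∷ [])
         (shifts (⦅ x , e ⦆ ∷ ⦅ x , f ⦆ ∷ []) (⦅ y , e ⦆ ∷ ⦅ y , f ⦆ ∷ [])) ⟩
  ⦅ y , x ⦆ ∷ ⦅ x , c ⦆ ∷ ⦅ x , d ⦆ ∷ ⦅ y , c ⦆ ∷ ⦅ y , d ⦆ ∷ ⦅ c , d ⦆ ∷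
  ⦅ x , y ⦆ ∷ ⦅ y , e ⦆ ∷ ⦅ y , f ⦆ ∷ ⦅ x , e ⦆ ∷ ⦅ x , f ⦆ ∷ ⦅ e , f ⦆ ∷ rest
    ↭⟨ ↭-exchange ⦅ y , x ⦆ ⦅ x , y ⦆ (⦅ x , c ⦆ ∷ ⦅ x , d ⦆ ∷ ⦅ y , c ⦆ ∷ ⦅ y , d ⦆ ∷ ⦅ c , d ⦆ ∷ []) _ ⟩
  ⦅ x , y ⦆ ∷ ⦅ x , c ⦆ ∷ ⦅ x , d ⦆ ∷ ⦅ y , c ⦆ ∷ ⦅ y , d ⦆ ∷ ⦅ c , d ⦆ ∷
  ⦅ y , x ⦆ ∷ ⦅ y , e ⦆ ∷ ⦅ y , f ⦆ ∷ ⦅ x , e ⦆ ∷ ⦅ x , f ⦆ ∷ ⦅ e , f ⦆ ∷ rest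
    ∎
  where
  open PermutationReasoning
  ⦅_,_⦆ = pairCode
  rest = allPairCodes bs

3≤commonPoints-swap : {x y c d : Fin v} → DistinctPoints (x ∷ y ∷ c ∷ d ∷ []) →
  3 ≤ commonPoints (y ∷ x ∷ c ∷ d ∷ []) (x ∷ y ∷ c ∷ d ∷ [])
3≤commonPoints-swap D = length≤commonPoints
  ((D₀₁ ∷ D₀₂ ∷ []) AllPairs.∷ (D₁₂ ∷ []) AllPairs.∷ [] AllPairs.∷ AllPairs.[])
  λ { (here refl) → second , first
    ; (there (here refl)) → first , second
    ; (there (there (here refl))) → third , third }
  where
  D₀₁ = D fzero (fsuc fzero) (λ ())
  D₀₂ = D fzero (fsuc (fsuc fzero)) (λ ())
  D₁₂ = D (fsuc fzero) (fsuc (fsuc fzero)) (λ ())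
  first : ∀ {n a} {as : Vec.Vec (Fin v) n} → a ∈ᵥ a ∷ as
  first = VecAny.here refl
  second : ∀ {n a p} {as : Vec.Vec (Fin v) n} → a ∈ᵥ p ∷ a ∷ as
  second = VecAny.there first
  third : ∀ {n a p q} {as : Vec.Vec (Fin v) n} → a ∈ᵥ p ∷ q ∷ a ∷ as
  third = VecAny.there second

module _ ⦃ _ : NonZero v ⦄ where

  open ListDec (Vecₚ.≡-dec {n = 4} (Fin._≟_ {v})) using (_∈?_)

  IsDefiningSet⇒meets-trade : PairBalanced bs → SuperSimple v bs → {S : List (Block v)} → IsDefiningSet v bs S →
    (t : Trade v) → tradeBlocks t ⊆ bs → Any (_∈ S) (tradeBlocks t)
  IsDefiningSet⇒meets-trade {bs} balanced superSimple {S} ((T , S++T↭bs) , unique) t@(trade x y c d e f) t⊆bs =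
    decidable-stable (any? (_∈? S) (tradeBlocks t)) λ misses →
      let
        first∈bs = t⊆bs (here refl)
        distinct = PairBalanced⇒DistinctPoints {bs = bs} balanced first∈bs
        x≢y : x ≢ y
        x≢y = distinct fzero (fsuc fzero) (λ ())
        inT : ∀ {w} → w ∈ tradeBlocks t → w ∈ T
        inT w∈t = ∈-complement {xs = S} S++T↭bs (t⊆bs w∈t) (misses ∘ lose w∈t)
        R , T↭ = ∈-∈⇒↭∷∷ (inT (here refl)) (inT (there (here refl))) (x≢y ∘ cong Vec.head)
        bs↭ : bs ↭ tradeBlocks t ++ S ++ R
        bs↭ = ↭-trans (↭-sym S++T↭bs) (↭-trans (++⁺ˡ S T↭) (shifts S (tradeBlocks t)))
        switched : PairBalanced (switchedBlocks t ++ S ++ R)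
        switched = ↭-trans (switch-preserves-pairCodes t (S ++ R)) (PairBalanced-resp-↭ bs↭ balanced)
        switched↭bs = unique _ (PairBalanced⇒IsDD switched) (switchedBlocks t ++ R , shifts S (switchedBlocks t))
      in x≢y (sym (cong Vec.head (SuperSimple-3≤commonPoints⇒≡ superSimple
           (∈-resp-↭ switched↭bs (here refl)) first∈bs (3≤commonPoints-swap distinct))))

  length≤hits : {S : List (Block v)} (P : List (Trade v)) → (∀ {t} → t ∈ P → Any (_∈ S) (tradeBlocks t)) →
    length P ≤ length (filter (_∈? S) (blocks P))
  length≤hits [] _ = z≤n
  length≤hits {S} (t ∷ P) meets = subst (suc (length P) ≤_) (sym length-filter-++)
    (+-mono-≤ (Any⇒1≤length-filter (_∈? S) (meets (here refl))) (length≤hits P (meets ∘ there)))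
    where
    length-filter-++ : length (filter (_∈? S) (tradeBlocks t ++ blocks P))
                     ≡ length (filter (_∈? S) (tradeBlocks t)) + length (filter (_∈? S) (blocks P))
    length-filter-++ = ≡.trans (cong length (filter-++ (_∈? S) (tradeBlocks t) _)) (length-++ (filter (_∈? S) (tradeBlocks t)))

  blocks-dAtLeastHalf : (P : List (Trade v)) → PairBalanced (blocks P) → SuperSimple v (blocks P) →
    Unique (blocks P) → dAtLeastHalf v (blocks P)
  blocks-dAtLeastHalf P balanced superSimple unique S definingSet = begin
    length (blocks P)                       ≡⟨ length-blocks P ⟩
    2 * length P                            ≤⟨ *-monoʳ-≤ 2 (length≤hits P meets) ⟩
    2 * length (filter (_∈? S) (blocks P))  ≤⟨ *-monoʳ-≤ 2 (Unique-⊆⇒length≤ (filter⁺ (_∈? S) unique) hits⊆S) ⟩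
    2 * length S                            ∎
    where
    open ≤-Reasoning
    meets : ∀ {t} → t ∈ P → Any (_∈ S) (tradeBlocks t)
    meets {t} t∈P = IsDefiningSet⇒meets-trade balanced superSimple definingSet t (∈-concatMap⁺′ tradeBlocks t∈P)
    hits⊆S : filter (_∈? S) (blocks P) ⊆ S
    hits⊆S = proj₂ ∘ ∈-filter⁻ (_∈? S) {xs = blocks P}

  trades⇒superSimpleDD : (P : List (Trade v)) → PairBalanced (blocks P) → Unique (allTripleCodes (blocks P)) →
    IsDD v (blocks P) × SuperSimple v (blocks P) × dAtLeastHalf v (blocks P)
  trades⇒superSimpleDD P balanced uniqueTriples =
    PairBalanced⇒IsDD {bs = blocks P} balanced , superSimple ,
    blocks-dAtLeastHalf P balanced superSimple (Unique-allTripleCodes⇒Unique {bs = blocks P} uniqueTriples)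
    where
    superSimple : SuperSimple v (blocks P)
    superSimple = Unique-allTripleCodes⇒SuperSimple {bs = blocks P} uniqueTriples

  superSimpleDD : (P : List (Trade v)) →
    {True (≡-dec _≟_ (sort (allPairCodes (blocks P))) (sort (expectedPairCodes v)))} →
    {True (linked? _<?_ (sort (allTripleCodes (blocks P))))} →
    Σ (List (Block v)) (λ bs → IsDD v bs × SuperSimple v bs × dAtLeastHalf v bs)
  superSimpleDD P {pairs} {triples} =
    blocks P , trades⇒superSimpleDD P (sort-≡⇒↭ (toWitness pairs)) (Linked<-sort⇒Unique (toWitness triples))

-- The designs

orbit : ⦃ _ : NonZero v ⦄ → ℕ → (x y c d e f : ℕ) → List (Trade v)
orbit {v} n x y c d e f = map translate (upTo n)
  where
  translate : ℕ → Trade v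
  translate s = trade ((x + s) mod v) ((y + s) mod v) ((c + s) mod v) ((d + s) mod v) ((e + s) mod v) ((f + s) mod v)

-- The last base trade is invariant under translation by 35, so its orbit has length 35.
trades70 : List (Trade 70)
trades70 =
  orbit 70 0 59 13 16 47 65 ++
  orbit 70 0 42 13 62 68 23 ++
  orbit 70 0 10 31 35 47 38 ++
  orbit 70 0 63 43 19 22 46 ++
  orbit 70 0 4 69 66 37 22 ++
  orbit 70 0 20 14 54 52 61 ++
  orbit 70 0 49 27 2 11 59 ++
  orbit 70 0 7 19 36 12 64 ++
  orbit 70 0 55 58 39 1 57 ++
  orbit 70 0 34 6 39 31 17 ++
  orbit 70 0 30 44 45 60 68 ++
  orbit 35 0 35 44 43 79 78

trades127 : List (Trade 127)
trades127 =
  orbit 127 0 63 113 92 31 49 ++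
  orbit 127 0 125 71 114 124 69 ++
  orbit 127 0 119 30 75 115 22 ++
  orbit 127 0 95 120 46 79 88 ++
  orbit 127 0 126 99 57 62 98 ++
  orbit 127 0 123 15 101 121 11 ++
  orbit 127 0 111 60 23 103 44 ++
  orbit 127 0 21 49 54 34 58 ++
  orbit 127 0 84 69 89 9 105 ++
  orbit 127 0 82 22 102 36 39 ++
  orbit 127 0 74 88 27 17 29 ++
  orbit 127 0 42 98 108 68 116 ++
  orbit 127 0 41 11 51 18 83 ++
  orbit 127 0 37 44 77 72 78 ++
  orbit 127 0 103 93 1 77 67 ++
  orbit 127 0 31 118 4 54 14 ++
  orbit 127 0 124 91 16 89 56 ++
  orbit 127 0 115 110 64 102 97 ++
  orbit 127 0 79 59 2 27 7 ++
  orbit 127 0 62 109 8 108 28 ++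
  orbit 127 0 121 55 32 51 112

lemma9 : (v : ℕ) → (v ≡ 70 ⊎ v ≡ 127) →
    Σ (List (Block v)) (λ B → IsDD v B × SuperSimple v B × dAtLeastHalf v B)
lemma9 _ (inj₁ refl) = superSimpleDD trades70
lemma9 _ (inj₂ refl) = superSimpleDD trades127
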